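{- For positive integers $k,\ell$ with $\ell\ge2$, we have $\theta_{LZ}(k,\ell)<\theta(k,\ell)$ if and only if $\ell=2$ or $k<\lambda_1(\ell)\ell$.
   Context: $\theta_{LZ}(k,\ell)=\min\big(\frac{5}{6k},\frac1\ell\big)$. $\theta(k,\ell)=\max(\theta_A(k,\ell),\theta_B(k,\ell))$, where $\theta_A(k,\ell)=\min\big(\frac{\lambda_1(\ell)}{k},\frac{\lambda_2(k,\ell)}{k},\frac{k}{\ell(k-1)}\big)$ and $\theta_B(k,\ell)=\min\big(\frac{5}{12k},\frac{k}{\ell(k-1)}\big)$; convention: for $k=1$, $\frac{k}{\ell(k-1)}=+\infty$ and $\min(A,\infty)=A$. Here $\lambda_1(\ell)=\frac{\ell}{2(\ell-1)}$ for $2\le\ell\le3$, $\frac{3\ell^2+2\sqrt3\ell^{3/2}+\ell}{(3\ell-1)^2}$ for $3\le\ell\le\frac{25}{3}$, $\frac{5\ell}{4(3\ell-5)}$ for $\ell\ge\frac{25}{3}$; $\lambda_2(k,\ell)=\frac23(\frac k\ell+\frac12)$ for $\frac58\ell\le k$, $\frac{10}{49}+\frac{2k}{7\ell}+\frac47\sqrt{\frac67(\frac k\ell-\frac17)}$ for $\frac{31}{96}\ell\le k\le\frac58\ell$, $\frac{10}{11}(\frac k\ell+\frac14)$ for $k\le\frac{31}{96}\ell$. -}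

module Defs where

open import Data.Nat as ℕ using (ℕ; _≤ᵇ_)
open import Data.Integer using (+_)
open import Data.Rational using (ℚ; _/_; 0ℚ; _+_; _-_; _*_; _÷_; _<_; _⊓_; ≢-nonZero)
open import Data.Rational.Properties using (_≟_)
open import Data.Bool using (if_then_else_)
open import Data.Product using (_×_)
open import Data.Sum using (_⊎_)
open import Data.Unit using (⊤)
open import Relation.Nullary using (yes; no)

ι : ℕ → ℚ
ι n = + n / 1

-- total division on ℚ (junk value 0 when dividing by 0; never used at 0 below)
_⊘_ : ℚ → ℚ → ℚ
p ⊘ q with q ≟ 0ℚ
... | yes _ = 0ℚ
... | no q≢0 = _÷_ p q {{≢-nonZero q≢0}}
infixl 7 _⊘_

-- Real numbers built from rationals by  a + b·√c  (with b ≥ 0, c ≥ 0 in all uses),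
-- +∞, min and max.  Such a real is determined by its strict lower Dedekind cut
-- { q ∈ ℚ | q < value }, which is what  _<ᴱ_  defines.
data RExpr : Set where
  surd : ℚ → ℚ → ℚ → RExpr          -- surd a b c  denotes  a + b * √c
  +∞   : RExpr
  rmin : RExpr → RExpr → RExpr
  rmax : RExpr → RExpr → RExpr

rat : ℚ → RExpr
rat a = surd a 0ℚ 0ℚ

-- q < a + b√c  (b ≥ 0, c ≥ 0)  iff  q - a < 0  or  (q - a)² < b² c
_<ᴱ_ : ℚ → RExpr → Set
q <ᴱ surd a b c = (q - a < 0ℚ) ⊎ ((q - a) * (q - a) < b * b * c)
q <ᴱ +∞         = ⊤
q <ᴱ rmin e f   = (q <ᴱ e) × (q <ᴱ f)
q <ᴱ rmax e f   = (q <ᴱ e) ⊎ (q <ᴱ f)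
infix 4 _<ᴱ_

-- multiplication of a real expression by a positive rational r
-- (r > 0 in all uses, so it commutes with min/max; r * ∞ = ∞)
scale : ℚ → RExpr → RExpr
scale r (surd a b c) = surd (r * a) (r * b) c
scale r +∞           = +∞
scale r (rmin e f)   = rmin (scale r e) (scale r f)
scale r (rmax e f)   = rmax (scale r e) (scale r f)

θLZ : ℕ → ℕ → ℚ
θLZ k ℓ = (ι 5 ⊘ ι (6 ℕ.* k)) ⊓ (ι 1 ⊘ ι ℓ)

-- λ₁(ℓ)
--   ℓ/(2(ℓ-1))                                   for 2 ≤ ℓ ≤ 3
--   (3ℓ² + 2√3 ℓ^{3/2} + ℓ)/(3ℓ-1)²              for 3 ≤ ℓ ≤ 25/3   (2√3 ℓ^{3/2} = 2√(3ℓ³))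
--   5ℓ/(4(3ℓ-5))                                  for ℓ ≥ 25/3
-- (the branches agree at ℓ = 3; ℓ = 25/3 is not an integer)
λ₁ : ℕ → RExpr
λ₁ ℓ =
  if ℓ ≤ᵇ 3
  then rat (L ⊘ (ι 2 * (L - ι 1)))
  else (if 3 ℕ.* ℓ ≤ᵇ 25
        then surd ((ι 3 * L * L + L) ⊘ D) (ι 2 ⊘ D) (ι 3 * L * L * L)
        else rat ((ι 5 * L) ⊘ (ι 4 * (ι 3 * L - ι 5))))
  where
    L = ι ℓ
    D = (ι 3 * L - ι 1) * (ι 3 * L - ι 1)

-- λ₂(k,ℓ), with x = k/ℓ
--   (2/3)(x + 1/2)                                      for x ≥ 5/8
--   10/49 + 2x/7 + (4/7)√((6/7)(x - 1/7))              for 31/96 ≤ x ≤ 5/8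
--   (10/11)(x + 1/4)                                    for x ≤ 31/96
-- (the branches agree at the boundary points)
λ₂ : ℕ → ℕ → RExpr
λ₂ k ℓ =
  if 5 ℕ.* ℓ ≤ᵇ 8 ℕ.* k
  then rat ((ι 2 ⊘ ι 3) * (x + ι 1 ⊘ ι 2))
  else (if 31 ℕ.* ℓ ≤ᵇ 96 ℕ.* k
        then surd (ι 10 ⊘ ι 49 + (ι 2 * x) ⊘ ι 7) (ι 4 ⊘ ι 7)
                  ((ι 6 ⊘ ι 7) * (x - ι 1 ⊘ ι 7))
        else rat ((ι 10 ⊘ ι 11) * (x + ι 1 ⊘ ι 4)))
  where
    x = ι k ⊘ ι ℓ

-- k/(ℓ(k-1)), which is +∞ for k = 1 (the paper's convention)
kTerm : ℕ → ℕ → RExpr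
kTerm 0       ℓ = +∞   -- not used (k ≥ 1)
kTerm 1       ℓ = +∞
kTerm k@(ℕ.suc (ℕ.suc _)) ℓ = rat (ι k ⊘ (ι ℓ * (ι k - ι 1)))

θA : ℕ → ℕ → RExpr
θA k ℓ = rmin (scale (ι 1 ⊘ ι k) (λ₁ ℓ)) (rmin (scale (ι 1 ⊘ ι k) (λ₂ k ℓ)) (kTerm k ℓ))

θB : ℕ → ℕ → RExpr
θB k ℓ = rmin (rat (ι 5 ⊘ ι (12 ℕ.* k))) (kTerm k ℓ)

θ : ℕ → ℕ → RExpr
θ k ℓ = rmax (θA k ℓ) (θB k ℓ)

module Submission where

-- Write q = θ_LZ(k,ℓ) = min(5/(6k), 1/ℓ) and x = k/ℓ.  The proof rests on two observations.
--  * q < θ(k,ℓ) holds exactly when k·q < λ₁(ℓ).  Indeed q ≤ 1/ℓ < k/(ℓ(k-1)) always,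
--    and k·q < λ₂(k,ℓ) always (k·q is x < 1 or 5/6 < λ₂), so θ_A reduces to its λ₁-term;
--    and q < 5/(12k) gives k·q < 5/12 < λ₁(ℓ), so θ_B never contributes anything new.
--  * k·q equals x when 6k ≤ 5ℓ and 5/6 when 5ℓ < 6k, while λ₁(2) = 1 and λ₁(ℓ) ≤ 5/6 for
--    ℓ ≥ 3.  So in the first regime k·q < λ₁(ℓ) iff x < λ₁(ℓ) (when ℓ = 2 both hold), and in
--    the second iff ℓ = 2 (then x ≥ 5/6 makes x < λ₁(ℓ) impossible unless ℓ = 2).

open import Defs
open import Data.Bool using (true; false; T; if_then_else_)
open import Data.Empty using (⊥-elim)
open import Data.Integer as ℤ using (+_; +<+; +≤+)
import Data.Integer.Properties as ℤP
open import Data.Nat as ℕ using (ℕ; suc; s≤s; z≤n; z<s; _≤ᵇ_)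
import Data.Nat.Properties as ℕP
open import Data.Nat.Tactic.RingSolver using (solve-∀)
open import Data.Product using (_,_)
open import Data.Product.Function.NonDependent.Propositional using (_×-⇔_)
open import Data.Rational as Q
  using (ℚ; 0ℚ; 1ℚ; _+_; _*_; _-_; _<_; _≤_; toℚᵘ; fromℚᵘ; 1/_; NonZero; ≢-nonZero; _÷_)
import Data.Rational.Properties as QP
open import Data.Rational.Solver using (module +-*-Solver)
open import Data.Rational.Unnormalised as U using (mkℚᵘ; *≡*; *<*; *≤*)
import Data.Rational.Unnormalised.Properties as UP
open import Data.Sum using (_⊎_; inj₁; inj₂; [_,_]′)
open import Data.Sum.Function.Propositional using (_⊎-⇔_)
open import Data.Unit using (tt)
open import Function.Base using (id; _∘_)
open import Function.Bundles using (_⇔_; mk⇔; Equivalence)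
open import Function.Properties.Equivalence using (⇔-isEquivalence)
open import Level using (0ℓ)
open import Relation.Binary.Definitions using (tri<; tri≈; tri>)
open import Relation.Binary.PropositionalEquality
open import Relation.Binary.Structures using (IsEquivalence)
open import Relation.Nullary using (Dec; yes; no; ¬_)
open import Relation.Nullary.Decidable using (_⊎-dec_; _×-dec_; toWitness; toWitnessFalse)

open +-*-Solver
open Equivalence using (to; from)
open IsEquivalence (⇔-isEquivalence {ℓ = 0ℓ}) using () renaming (refl to ⇔-refl; sym to ⇔-sym; trans to ⇔-trans)

frac : ℕ → ℕ → ℚ
frac a b = ι a ⊘ ι b

⊘-nonZero : ∀ p q (q≢0 : q ≢ 0ℚ) → p ⊘ q ≡ _÷_ p q {{≢-nonZero q≢0}}
⊘-nonZero p q q≢0 with q QP.≟ 0ℚ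
... | yes q≡0 = ⊥-elim (q≢0 q≡0)
... | no _    = refl

ᵘ-< : ∀ {a b c d} → a ℕ.* suc d ℕ.< c ℕ.* suc b → mkℚᵘ (+ a) b U.< mkℚᵘ (+ c) d
ᵘ-< {a} {b} {c} {d} h = *<* (subst₂ ℤ._<_ (ℤP.pos-* a (suc d)) (ℤP.pos-* c (suc b)) (+<+ h))

ᵘ-≤ : ∀ {a b c d} → a ℕ.* suc d ℕ.≤ c ℕ.* suc b → mkℚᵘ (+ a) b U.≤ mkℚᵘ (+ c) d
ᵘ-≤ {a} {b} {c} {d} h = *≤* (subst₂ ℤ._≤_ (ℤP.pos-* a (suc d)) (ℤP.pos-* c (suc b)) (+≤+ h))

ᵘ-≃ : ∀ {a b c d} → a ℕ.* suc d ≡ c ℕ.* suc b → mkℚᵘ (+ a) b U.≃ mkℚᵘ (+ c) d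
ᵘ-≃ {a} {b} {c} {d} h = *≡* (trans (sym (ℤP.pos-* a (suc d))) (trans (cong +_ h) (ℤP.pos-* c (suc b))))

ᵘ-+ : ∀ a b c d → mkℚᵘ (+ a) b U.+ mkℚᵘ (+ c) d
                  ≡ mkℚᵘ (+ (a ℕ.* suc d ℕ.+ c ℕ.* suc b)) (d ℕ.+ b ℕ.* suc d)
ᵘ-+ a b c d = cong (λ n → mkℚᵘ n (d ℕ.+ b ℕ.* suc d))
  (trans (cong₂ ℤ._+_ (sym (ℤP.pos-* a (suc d))) (sym (ℤP.pos-* c (suc b))))
         (sym (ℤP.pos-+ (a ℕ.* suc d) (c ℕ.* suc b))))

ᵘ-* : ∀ a b c d → mkℚᵘ (+ a) b U.* mkℚᵘ (+ c) d ≡ mkℚᵘ (+ (a ℕ.* c)) (d ℕ.+ b ℕ.* suc d)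
ᵘ-* a b c d = cong (λ n → mkℚᵘ n (d ℕ.+ b ℕ.* suc d)) (sym (ℤP.pos-* a c))

via-ᵘ-≡ : ∀ {p q u v} → toℚᵘ p U.≃ u → toℚᵘ q U.≃ v → u U.≃ v → p ≡ q
via-ᵘ-≡ p≃u q≃v u≃v = QP.toℚᵘ-injective (UP.≃-trans p≃u (UP.≃-trans u≃v (UP.≃-sym q≃v)))

via-ᵘ-< : ∀ {p q u v} → toℚᵘ p U.≃ u → toℚᵘ q U.≃ v → u U.< v → p < q
via-ᵘ-< p≃u q≃v u<v = QP.toℚᵘ-cancel-< (UP.<-respˡ-≃ (UP.≃-sym p≃u) (UP.<-respʳ-≃ (UP.≃-sym q≃v) u<v))

via-ᵘ-≤ : ∀ {p q u v} → toℚᵘ p U.≃ u → toℚᵘ q U.≃ v → u U.≤ v → p ≤ q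
via-ᵘ-≤ p≃u q≃v u≤v = QP.toℚᵘ-cancel-≤ (UP.≤-respˡ-≃ (UP.≃-sym p≃u) (UP.≤-respʳ-≃ (UP.≃-sym q≃v) u≤v))

ι-toℚᵘ : ∀ n → toℚᵘ (ι n) U.≃ mkℚᵘ (+ n) 0
ι-toℚᵘ n = QP.toℚᵘ-fromℚᵘ (mkℚᵘ (+ n) 0)

ι-pos : ∀ n → 0ℚ < ι (suc n)
ι-pos n = via-ᵘ-< (ι-toℚᵘ 0) (ι-toℚᵘ (suc n)) (ᵘ-< z<s)

ι-suc≢0 : ∀ n → ι (suc n) ≢ 0ℚ
ι-suc≢0 n ι≡0 = QP.<-irrefl (sym ι≡0) (ι-pos n)

ι-+ : ∀ m n → ι (m ℕ.+ n) ≡ ι m + ι n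
ι-+ m n = via-ᵘ-≡ (ι-toℚᵘ (m ℕ.+ n))
  (UP.≃-trans (QP.toℚᵘ-homo-+ (ι m) (ι n)) (UP.+-cong (ι-toℚᵘ m) (ι-toℚᵘ n)))
  (UP.≃-trans (ᵘ-≃ (eq m n)) (UP.≃-reflexive (sym (ᵘ-+ m 0 n 0))))
  where
  eq : ∀ m n → (m ℕ.+ n) ℕ.* 1 ≡ (m ℕ.* 1 ℕ.+ n ℕ.* 1) ℕ.* 1
  eq = solve-∀

ι-difference : ∀ m n → ι (m ℕ.+ n) - ι m ≡ ι n
ι-difference m n = trans (cong (_- ι m) (ι-+ m n)) (solve 2 (λ a b → (a :+ b) :- a := b) refl (ι m) (ι n))

frac-toℚᵘ : ∀ a b → toℚᵘ (frac a (suc b)) U.≃ mkℚᵘ (+ a) b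
frac-toℚᵘ a b = subst (λ p → toℚᵘ p U.≃ mkℚᵘ (+ a) b) (sym frac≡f) (QP.toℚᵘ-fromℚᵘ (mkℚᵘ (+ a) b))
  where
  f : ℚ
  f = fromℚᵘ (mkℚᵘ (+ a) b)
  instance
    ιb≢0 : NonZero (ι (suc b))
    ιb≢0 = ≢-nonZero (ι-suc≢0 b)
  f*b≡a : f * ι (suc b) ≡ ι a
  f*b≡a = via-ᵘ-≡
    (UP.≃-trans (QP.toℚᵘ-homo-* f (ι (suc b))) (UP.*-cong (QP.toℚᵘ-fromℚᵘ (mkℚᵘ (+ a) b)) (ι-toℚᵘ (suc b))))
    (ι-toℚᵘ a)
    (UP.≃-trans (UP.≃-reflexive (ᵘ-* a b (suc b) 0)) (ᵘ-≃ (eq a b)))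
    where
    eq : ∀ a b → a ℕ.* suc b ℕ.* 1 ≡ a ℕ.* suc (0 ℕ.+ b ℕ.* 1)
    eq = solve-∀
  frac≡f : frac a (suc b) ≡ f
  frac≡f = begin
    ι a ⊘ ι (suc b)                    ≡⟨ ⊘-nonZero (ι a) (ι (suc b)) (ι-suc≢0 b) ⟩
    ι a * 1/ ι (suc b)                 ≡⟨ cong (_* 1/ ι (suc b)) (sym f*b≡a) ⟩
    (f * ι (suc b)) * 1/ ι (suc b)     ≡⟨ QP.*-assoc f _ _ ⟩
    f * (ι (suc b) * 1/ ι (suc b))     ≡⟨ cong (f *_) (QP.*-inverseʳ (ι (suc b))) ⟩
    f * 1ℚ                             ≡⟨ QP.*-identityʳ f ⟩
    f                                  ∎
    where open ≡-Reasoning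

frac-< : ∀ {a b c d} → a ℕ.* suc d ℕ.< c ℕ.* suc b → frac a (suc b) < frac c (suc d)
frac-< {a} {b} {c} {d} h = via-ᵘ-< (frac-toℚᵘ a b) (frac-toℚᵘ c d) (ᵘ-< h)

frac-≤ : ∀ {a b c d} → a ℕ.* suc d ℕ.≤ c ℕ.* suc b → frac a (suc b) ≤ frac c (suc d)
frac-≤ {a} {b} {c} {d} h = via-ᵘ-≤ (frac-toℚᵘ a b) (frac-toℚᵘ c d) (ᵘ-≤ h)

frac-≡ : ∀ {a b c d} → a ℕ.* suc d ≡ c ℕ.* suc b → frac a (suc b) ≡ frac c (suc d)
frac-≡ {a} {b} {c} {d} h = via-ᵘ-≡ (frac-toℚᵘ a b) (frac-toℚᵘ c d) (ᵘ-≃ h)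

frac-pos : ∀ a b → 0ℚ < frac (suc a) (suc b)
frac-pos a b = frac-< {0} {0} {suc a} {b} z<s

ι-frac : ∀ a → ι a ≡ frac a 1
ι-frac a = via-ᵘ-≡ (ι-toℚᵘ a) (frac-toℚᵘ a 0) UP.≃-refl

ι-*-frac : ∀ n a b → ι n * frac a (suc b) ≡ frac (n ℕ.* a) (suc b)
ι-*-frac n a b = via-ᵘ-≡
  (UP.≃-trans (QP.toℚᵘ-homo-* (ι n) (frac a (suc b))) (UP.*-cong (ι-toℚᵘ n) (frac-toℚᵘ a b)))
  (frac-toℚᵘ (n ℕ.* a) b)
  (UP.≃-trans (UP.≃-reflexive (ᵘ-* n 0 a b)) (ᵘ-≃ (eq n a b)))
  where
  eq : ∀ n a b → n ℕ.* a ℕ.* suc b ≡ n ℕ.* a ℕ.* suc (b ℕ.+ 0 ℕ.* suc b)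
  eq = solve-∀

ι-* : ∀ m n → ι m * ι n ≡ ι (m ℕ.* n)
ι-* m n = trans (cong (ι m *_) (ι-frac n)) (trans (ι-*-frac m n 0) (sym (ι-frac (m ℕ.* n))))

ι-*-unit-frac : ∀ k ℓ' → ι k * frac 1 (suc ℓ') ≡ frac k (suc ℓ')
ι-*-unit-frac k ℓ' = trans (ι-*-frac k 1 ℓ') (cong (λ a → frac a (suc ℓ')) (ℕP.*-identityʳ k))

ι-*-inverse : ∀ n → ι (suc n) * frac 1 (suc n) ≡ 1ℚ
ι-*-inverse n = trans (ι-*-unit-frac (suc n) n) (frac-≡ {suc n} {n} {1} {0} (ℕP.*-comm (suc n) 1))

ι-*-frac-cancel : ∀ k' a c → ι (suc k') * frac a (suc c ℕ.* suc k') ≡ frac a (suc c)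
ι-*-frac-cancel k' a c = trans (ι-*-frac (suc k') a (ℕ.pred (suc c ℕ.* suc k')))
                                (frac-≡ {suc k' ℕ.* a} {ℕ.pred (suc c ℕ.* suc k')} {a} {c} (eq (suc k') a c))
  where
  eq : ∀ k a c → k ℕ.* a ℕ.* suc c ≡ a ℕ.* (suc c ℕ.* k)
  eq = solve-∀

*-<-⇔ : ∀ {r x y x' y'} → 0ℚ < r → r * x ≡ x' → r * y ≡ y' → (x < y ⇔ x' < y')
*-<-⇔ {r} 0<r rx≡x' ry≡y' = mk⇔
  (λ x<y → subst₂ _<_ rx≡x' ry≡y' (QP.*-monoʳ-<-pos r {{Q.positive 0<r}} x<y))
  (λ x'<y' → QP.*-cancelˡ-<-nonNeg r {{Q.nonNegative (QP.<⇒≤ 0<r)}} (subst₂ _<_ (sym rx≡x') (sym ry≡y') x'<y'))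

-<0⇔< : ∀ q a → (q - a < 0ℚ) ⇔ (q < a)
-<0⇔< q a = mk⇔
  (λ q-a<0 → subst₂ _<_ (solve 2 (λ q a → (q :- a) :+ a := q) refl q a) (QP.+-identityˡ a) (QP.+-monoˡ-< a q-a<0))
  (λ q<a → subst (q - a <_) (QP.+-inverseʳ a) (QP.+-monoˡ-< (Q.- a) q<a))

0<-⇒< : ∀ {a b} → 0ℚ < b - a → a < b
0<-⇒< {a} {b} 0<b-a = subst₂ _<_ (QP.+-identityˡ a) (solve 2 (λ a b → (b :- a) :+ a := b) refl a b) (QP.+-monoˡ-< a 0<b-a)

<⇒0<- : ∀ {a b} → a < b → 0ℚ < b - a
<⇒0<- {a} {b} a<b = subst (_< b - a) (QP.+-inverseʳ a) (QP.+-monoˡ-< (Q.- a) a<b)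

≤⇒0≤- : ∀ {a b} → a ≤ b → 0ℚ ≤ b - a
≤⇒0≤- {a} {b} a≤b = subst (_≤ b - a) (QP.+-inverseʳ a) (QP.+-monoˡ-≤ (Q.- a) a≤b)

0≤+0< : ∀ {a b} → 0ℚ ≤ a → 0ℚ < b → 0ℚ < a + b
0≤+0< = QP.+-mono-≤-<

0≤* : ∀ {a b} → 0ℚ ≤ a → 0ℚ ≤ b → 0ℚ ≤ a * b
0≤* {a} {b} 0≤a 0≤b = QP.nonNegative⁻¹ (a * b) {{QP.nonNeg*nonNeg⇒nonNeg a {{Q.nonNegative 0≤a}} b {{Q.nonNegative 0≤b}}}}

0<* : ∀ {a b} → 0ℚ < a → 0ℚ < b → 0ℚ < a * b
0<* {a} {b} 0<a 0<b = QP.positive⁻¹ (a * b) {{QP.pos*pos⇒pos a {{Q.positive 0<a}} b {{Q.positive 0<b}}}}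

square-≮0 : ∀ x → ¬ (x * x < 0ℚ)
square-≮0 x xx<0 with QP.<-cmp x 0ℚ
... | tri< x<0 _ _ = QP.<-asym xx<0 (QP.positive⁻¹ (x * x) {{QP.neg*neg⇒pos x {{Q.negative x<0}} x {{Q.negative x<0}}}})
... | tri≈ _ refl _ = QP.<-irrefl refl xx<0
... | tri> _ _ 0<x = QP.<-asym xx<0 (0<* 0<x 0<x)

square-mono : ∀ {x y} → 0ℚ ≤ x → x ≤ y → x * x ≤ y * y
square-mono {x} {y} 0≤x x≤y = QP.≤-trans
  (QP.*-monoˡ-≤-nonNeg x {{Q.nonNegative 0≤x}} x≤y)
  (QP.*-monoʳ-≤-nonNeg y {{Q.nonNegative (QP.≤-trans 0≤x x≤y)}} x≤y)

<ᴱ-rat : ∀ q a → (q <ᴱ rat a) ⇔ (q < a)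
<ᴱ-rat q a = mk⇔ from-cut (inj₁ ∘ from (-<0⇔< q a))
  where
  from-cut : q <ᴱ rat a → q < a
  from-cut (inj₁ q-a<0) = to (-<0⇔< q a) q-a<0
  from-cut (inj₂ square<0) = ⊥-elim (square-≮0 (q - a) square<0)

<ᴱ-downward : ∀ {q q'} e → q ≤ q' → q' <ᴱ e → q <ᴱ e
<ᴱ-downward (surd a b c) q≤q' (inj₁ q'-a<0) = inj₁ (QP.≤-<-trans (QP.+-monoˡ-≤ (Q.- a) q≤q') q'-a<0)
<ᴱ-downward {q} {q'} (surd a b c) q≤q' (inj₂ square<) with q - a Q.<? 0ℚ
... | yes q-a<0 = inj₁ q-a<0
... | no q-a≮0  = inj₂ (QP.≤-<-trans (square-mono (QP.≮⇒≥ q-a≮0) (QP.+-monoˡ-≤ (Q.- a) q≤q')) square<)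
<ᴱ-downward +∞         _   _          = tt
<ᴱ-downward (rmin e f) q≤q' (q'<e , q'<f) = <ᴱ-downward e q≤q' q'<e , <ᴱ-downward f q≤q' q'<f
<ᴱ-downward (rmax e f) q≤q' (inj₁ q'<e) = inj₁ (<ᴱ-downward e q≤q' q'<e)
<ᴱ-downward (rmax e f) q≤q' (inj₂ q'<f) = inj₂ (<ᴱ-downward f q≤q' q'<f)

<ᴱ-scale : ∀ {s} q e → 0ℚ < s → (q <ᴱ e) ⇔ (s * q <ᴱ scale s e)
<ᴱ-scale {s} q (surd a b c) 0<s =
  *-<-⇔ 0<s (difference s q a) (QP.*-zeroʳ s) ⊎-⇔ *-<-⇔ (0<* 0<s 0<s) (square s q a) (radicand s b c)
  where
  difference : ∀ s q a → s * (q - a) ≡ s * q - s * a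
  difference = solve 3 (λ s q a → s :* (q :- a) := s :* q :- s :* a) refl
  square : ∀ s q a → (s * s) * ((q - a) * (q - a)) ≡ (s * q - s * a) * (s * q - s * a)
  square = solve 3 (λ s q a → (s :* s) :* ((q :- a) :* (q :- a)) := (s :* q :- s :* a) :* (s :* q :- s :* a)) refl
  radicand : ∀ s b c → (s * s) * (b * b * c) ≡ s * b * (s * b) * c
  radicand = solve 3 (λ s b c → (s :* s) :* (b :* b :* c) := s :* b :* (s :* b) :* c) refl
<ᴱ-scale q +∞         0<s = ⇔-refl
<ᴱ-scale q (rmin e f) 0<s = <ᴱ-scale q e 0<s ×-⇔ <ᴱ-scale q f 0<s
<ᴱ-scale q (rmax e f) 0<s = <ᴱ-scale q e 0<s ⊎-⇔ <ᴱ-scale q f 0<s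

scale-∘ : ∀ s r e → scale s (scale r e) ≡ scale (s * r) e
scale-∘ s r (surd a b c) = cong₂ (λ a' b' → surd a' b' c) (sym (QP.*-assoc s r a)) (sym (QP.*-assoc s r b))
scale-∘ s r +∞           = refl
scale-∘ s r (rmin e f)   = cong₂ rmin (scale-∘ s r e) (scale-∘ s r f)
scale-∘ s r (rmax e f)   = cong₂ rmax (scale-∘ s r e) (scale-∘ s r f)

scale-one : ∀ e → scale 1ℚ e ≡ e
scale-one (surd a b c) = cong₂ (λ a' b' → surd a' b' c) (QP.*-identityˡ a) (QP.*-identityˡ b)
scale-one +∞           = refl
scale-one (rmin e f)   = cong₂ rmin (scale-one e) (scale-one f)
scale-one (rmax e f)   = cong₂ rmax (scale-one e) (scale-one f)

<ᴱ-unscale : ∀ {s r} q e → 0ℚ < s → s * r ≡ 1ℚ → (q <ᴱ scale r e) ⇔ (s * q <ᴱ e)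
<ᴱ-unscale {s} {r} q e 0<s sr≡1 = subst (λ e' → (q <ᴱ scale r e) ⇔ (s * q <ᴱ e')) scale-cancels (<ᴱ-scale q (scale r e) 0<s)
  where
  scale-cancels : scale s (scale r e) ≡ e
  scale-cancels = trans (scale-∘ s r e) (trans (cong (λ t → scale t e) sr≡1) (scale-one e))

-- Cuts are decidable; this evaluates the finitely many numerical facts about λ₁.
<ᴱ-dec : ∀ q e → Dec (q <ᴱ e)
<ᴱ-dec q (surd a b c) = ((q - a) Q.<? 0ℚ) ⊎-dec (((q - a) * (q - a)) Q.<? (b * b * c))
<ᴱ-dec q +∞           = yes tt
<ᴱ-dec q (rmin e f)   = <ᴱ-dec q e ×-dec <ᴱ-dec q f
<ᴱ-dec q (rmax e f)   = <ᴱ-dec q e ⊎-dec <ᴱ-dec q f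

if-elim : ∀ (P : RExpr → Set) b {e₁ e₂} → (T b → P e₁) → (¬ T b → P e₂) → P (if b then e₁ else e₂)
if-elim P true  if-true _        = if-true tt
if-elim P false _       if-false = if-false id

if-¬T : ∀ b {e₁ e₂ : RExpr} → ¬ T b → (if b then e₁ else e₂) ≡ e₂
if-¬T true  ¬T = ⊥-elim (¬T tt)
if-¬T false _  = refl

¬≤ᵇ⇒> : ∀ m n → ¬ T (m ≤ᵇ n) → n ℕ.< m
¬≤ᵇ⇒> m n ¬T = ℕP.≰⇒> (¬T ∘ ℕP.≤⇒≤ᵇ)

two-or-more : ∀ {ℓ} → 2 ℕ.≤ ℓ → (ℓ ≡ 2) ⊎ (3 ℕ.≤ ℓ)
two-or-more 2≤ℓ = [ inj₂ , inj₁ ∘ sym ]′ (ℕP.m≤n⇒m<n∨m≡n 2≤ℓ)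

-- For ℓ = 9 + m ≥ 25/3 the third branch gives λ₁(ℓ) = 5ℓ / (4(3ℓ - 5)), with 3ℓ - 5 = 22 + 3m.
λ₁-tail : ∀ m → λ₁ (9 ℕ.+ m) ≡ rat (frac (5 ℕ.* (9 ℕ.+ m)) (4 ℕ.* (22 ℕ.+ 3 ℕ.* m)))
λ₁-tail m = trans (if-¬T (3 ℕ.* ℓ ≤ᵇ 25) (ℕP.<⇒≱ 25<3ℓ ∘ ℕP.≤ᵇ⇒≤ (3 ℕ.* ℓ) 25))
                  (cong rat (cong₂ _⊘_ (ι-* 5 ℓ) denominator))
  where
  ℓ : ℕ
  ℓ = 9 ℕ.+ m
  3ℓ≡5+n : 3 ℕ.* ℓ ≡ 5 ℕ.+ (22 ℕ.+ 3 ℕ.* m)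
  3ℓ≡5+n = eq m
    where
    eq : ∀ m → 3 ℕ.* (9 ℕ.+ m) ≡ 5 ℕ.+ (22 ℕ.+ 3 ℕ.* m)
    eq = solve-∀
  25<3ℓ : 25 ℕ.< 3 ℕ.* ℓ
  25<3ℓ = subst (25 ℕ.<_) (sym 3ℓ≡5+n) (ℕP.m≤m+n 26 (1 ℕ.+ 3 ℕ.* m))
  denominator : ι 4 * (ι 3 * ι ℓ - ι 5) ≡ ι (4 ℕ.* (22 ℕ.+ 3 ℕ.* m))
  denominator = begin
    ι 4 * (ι 3 * ι ℓ - ι 5)              ≡⟨ cong (λ t → ι 4 * (t - ι 5)) (trans (ι-* 3 ℓ) (cong ι 3ℓ≡5+n)) ⟩
    ι 4 * (ι (5 ℕ.+ (22 ℕ.+ 3 ℕ.* m)) - ι 5) ≡⟨ cong (ι 4 *_) (ι-difference 5 (22 ℕ.+ 3 ℕ.* m)) ⟩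
    ι 4 * ι (22 ℕ.+ 3 ℕ.* m)              ≡⟨ ι-* 4 (22 ℕ.+ 3 ℕ.* m) ⟩
    ι (4 ℕ.* (22 ℕ.+ 3 ℕ.* m))            ∎
    where open ≡-Reasoning

λ₁-tail-above-5/12 : ∀ m → frac 5 12 < frac (5 ℕ.* (9 ℕ.+ m)) (4 ℕ.* (22 ℕ.+ 3 ℕ.* m))
λ₁-tail-above-5/12 m = frac-< {5} {11} {5 ℕ.* (9 ℕ.+ m)} {ℕ.pred (4 ℕ.* (22 ℕ.+ 3 ℕ.* m))}
  (subst₂ ℕ._<_ (sym (lhs m)) (sym (rhs m)) (ℕP.+-monoˡ-< (60 ℕ.* m) (ℕP.m<n+m 440 {100} z<s)))
  where
  lhs : ∀ m → 5 ℕ.* (4 ℕ.* (22 ℕ.+ 3 ℕ.* m)) ≡ 440 ℕ.+ 60 ℕ.* m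
  lhs = solve-∀
  rhs : ∀ m → 5 ℕ.* (9 ℕ.+ m) ℕ.* 12 ≡ 540 ℕ.+ 60 ℕ.* m
  rhs = solve-∀

λ₁-tail-≤-5/6 : ∀ m → frac (5 ℕ.* (9 ℕ.+ m)) (4 ℕ.* (22 ℕ.+ 3 ℕ.* m)) ≤ frac 5 6
λ₁-tail-≤-5/6 m = frac-≤ {5 ℕ.* (9 ℕ.+ m)} {ℕ.pred (4 ℕ.* (22 ℕ.+ 3 ℕ.* m))} {5} {5}
  (subst₂ ℕ._≤_ (sym (lhs m)) (sym (rhs m)) (ℕP.m≤n+m (270 ℕ.+ 30 ℕ.* m) (170 ℕ.+ 30 ℕ.* m)))
  where
  lhs : ∀ m → 5 ℕ.* (9 ℕ.+ m) ℕ.* 6 ≡ 270 ℕ.+ 30 ℕ.* m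
  lhs = solve-∀
  rhs : ∀ m → 5 ℕ.* (4 ℕ.* (22 ℕ.+ 3 ℕ.* m)) ≡ (170 ℕ.+ 30 ℕ.* m) ℕ.+ (270 ℕ.+ 30 ℕ.* m)
  rhs = solve-∀

λ₁-above-5/12 : ∀ ℓ → 2 ℕ.≤ ℓ → frac 5 12 <ᴱ λ₁ ℓ
λ₁-above-5/12 0 ()
λ₁-above-5/12 1 (s≤s ())
λ₁-above-5/12 2 _ = toWitness {a? = <ᴱ-dec (frac 5 12) (λ₁ 2)} tt
λ₁-above-5/12 3 _ = toWitness {a? = <ᴱ-dec (frac 5 12) (λ₁ 3)} tt
λ₁-above-5/12 4 _ = toWitness {a? = <ᴱ-dec (frac 5 12) (λ₁ 4)} tt
λ₁-above-5/12 5 _ = toWitness {a? = <ᴱ-dec (frac 5 12) (λ₁ 5)} tt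
λ₁-above-5/12 6 _ = toWitness {a? = <ᴱ-dec (frac 5 12) (λ₁ 6)} tt
λ₁-above-5/12 7 _ = toWitness {a? = <ᴱ-dec (frac 5 12) (λ₁ 7)} tt
λ₁-above-5/12 8 _ = toWitness {a? = <ᴱ-dec (frac 5 12) (λ₁ 8)} tt
λ₁-above-5/12 (suc (suc (suc (suc (suc (suc (suc (suc (suc m))))))))) _ =
  subst (frac 5 12 <ᴱ_) (sym (λ₁-tail m)) (from (<ᴱ-rat _ _) (λ₁-tail-above-5/12 m))

λ₁-below-5/6 : ∀ ℓ → 3 ℕ.≤ ℓ → ¬ (frac 5 6 <ᴱ λ₁ ℓ)
λ₁-below-5/6 0 ()
λ₁-below-5/6 1 (s≤s ())
λ₁-below-5/6 2 (s≤s (s≤s ()))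
λ₁-below-5/6 3 _ = toWitnessFalse {a? = <ᴱ-dec (frac 5 6) (λ₁ 3)} tt
λ₁-below-5/6 4 _ = toWitnessFalse {a? = <ᴱ-dec (frac 5 6) (λ₁ 4)} tt
λ₁-below-5/6 5 _ = toWitnessFalse {a? = <ᴱ-dec (frac 5 6) (λ₁ 5)} tt
λ₁-below-5/6 6 _ = toWitnessFalse {a? = <ᴱ-dec (frac 5 6) (λ₁ 6)} tt
λ₁-below-5/6 7 _ = toWitnessFalse {a? = <ᴱ-dec (frac 5 6) (λ₁ 7)} tt
λ₁-below-5/6 8 _ = toWitnessFalse {a? = <ᴱ-dec (frac 5 6) (λ₁ 8)} tt
λ₁-below-5/6 (suc (suc (suc (suc (suc (suc (suc (suc (suc m))))))))) _ 5/6<λ₁ =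
  QP.<-irrefl refl (QP.<-≤-trans (to (<ᴱ-rat _ _) (subst (frac 5 6 <ᴱ_) (λ₁-tail m) 5/6<λ₁)) (λ₁-tail-≤-5/6 m))

λ₁-above-5/6⇔ℓ≡2 : ∀ ℓ → 2 ℕ.≤ ℓ → (frac 5 6 <ᴱ λ₁ ℓ) ⇔ (ℓ ≡ 2)
λ₁-above-5/6⇔ℓ≡2 ℓ 2≤ℓ = mk⇔ only-two (λ { refl → toWitness {a? = <ᴱ-dec (frac 5 6) (λ₁ 2)} tt })
  where
  only-two : frac 5 6 <ᴱ λ₁ ℓ → ℓ ≡ 2
  only-two 5/6<λ₁ = [ id , (λ 3≤ℓ → ⊥-elim (λ₁-below-5/6 ℓ 3≤ℓ 5/6<λ₁)) ]′ (two-or-more 2≤ℓ)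

small-regime⇒k<ℓ : ∀ k ℓ' → 6 ℕ.* k ℕ.≤ 5 ℕ.* suc ℓ' → k ℕ.< suc ℓ'
small-regime⇒k<ℓ k ℓ' 6k≤5ℓ = ℕP.≰⇒> (λ ℓ≤k →
  ℕP.<⇒≱ (ℕP.<-≤-trans (ℕP.*-monoˡ-< (suc ℓ') (ℕP.n<1+n 5)) (ℕP.*-monoʳ-≤ 6 ℓ≤k)) 6k≤5ℓ)

frac<1 : ∀ k ℓ' → k ℕ.< suc ℓ' → frac k (suc ℓ') < 1ℚ
frac<1 k ℓ' k<ℓ = frac-< {k} {ℓ'} {1} {0} (subst₂ ℕ._<_ (sym (ℕP.*-identityʳ k)) (sym (ℕP.*-identityˡ (suc ℓ'))) k<ℓ)

5/6≤frac : ∀ k ℓ' → 5 ℕ.* suc ℓ' ℕ.≤ 6 ℕ.* k → frac 5 6 ≤ frac k (suc ℓ')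
5/6≤frac k ℓ' 5ℓ≤6k = frac-≤ {5} {5} {k} {ℓ'} (subst (5 ℕ.* suc ℓ' ℕ.≤_) (ℕP.*-comm 6 k) 5ℓ≤6k)

-- In its middle branch 31/96 ≤ x < 5/8, the surd defining λ₂ exceeds x; this rests on
--   (4/7)²·(6/7)(x - 1/7) - (x - a)² = (25/37632)(96x - 31)(5 - 8x) + (3304x + 803)/37632.
λ₂-middle-above-diagonal : ∀ k ℓ' → let x = frac k (suc ℓ') in
  31 ℕ.* suc ℓ' ℕ.≤ 96 ℕ.* k → 8 ℕ.* k ℕ.< 5 ℕ.* suc ℓ' →
  x <ᴱ surd (ι 10 ⊘ ι 49 + (ι 2 * x) ⊘ ι 7) (ι 4 ⊘ ι 7) ((ι 6 ⊘ ι 7) * (x - ι 1 ⊘ ι 7))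
λ₂-middle-above-diagonal k ℓ' 31ℓ≤96k 8k<5ℓ = inj₂ (0<-⇒< (subst (0ℚ <_) (sym gap) 0<gap))
  where
  ℓ : ℕ
  ℓ = suc ℓ'
  x : ℚ
  x = frac k ℓ
  a : ℚ
  a = ι 10 ⊘ ι 49 + (ι 2 * x) ⊘ ι 7
  b : ℚ
  b = ι 4 ⊘ ι 7
  c : ℚ
  c = (ι 6 ⊘ ι 7) * (x - ι 1 ⊘ ι 7)
  gap : b * b * c - (x - a) * (x - a)
        ≡ frac 25 37632 * ((ι 96 * x - ι 31) * (ι 5 - ι 8 * x)) + frac 3304 37632 * x + frac 803 37632
  gap = solve 1 (λ x →
      let a = con (ι 10 ⊘ ι 49) :+ (con (ι 2) :* x) :* con (1/ ι 7)
          b = con (ι 4 ⊘ ι 7)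
          c = con (ι 6 ⊘ ι 7) :* (x :- con (ι 1 ⊘ ι 7))
      in b :* b :* c :- (x :- a) :* (x :- a)
         := con (frac 25 37632) :* ((con (ι 96) :* x :- con (ι 31)) :* (con (ι 5) :- con (ι 8) :* x))
            :+ con (frac 3304 37632) :* x :+ con (frac 803 37632)) refl x
  31≤96x : ι 31 ≤ ι 96 * x
  31≤96x = subst₂ _≤_ (sym (ι-frac 31)) (sym (ι-*-frac 96 k ℓ'))
    (frac-≤ {31} {0} {96 ℕ.* k} {ℓ'} (subst (31 ℕ.* ℓ ℕ.≤_) (sym (ℕP.*-identityʳ (96 ℕ.* k))) 31ℓ≤96k))
  8x<5 : ι 8 * x < ι 5
  8x<5 = subst₂ _<_ (sym (ι-*-frac 8 k ℓ')) (sym (ι-frac 5))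
    (frac-< {8 ℕ.* k} {ℓ'} {5} {0} (subst (ℕ._< 5 ℕ.* ℓ) (sym (ℕP.*-identityʳ (8 ℕ.* k))) 8k<5ℓ))
  0≤x : 0ℚ ≤ x
  0≤x = frac-≤ {0} {0} {k} {ℓ'} z≤n
  0<gap : 0ℚ < frac 25 37632 * ((ι 96 * x - ι 31) * (ι 5 - ι 8 * x)) + frac 3304 37632 * x + frac 803 37632
  0<gap = 0≤+0< (QP.+-mono-≤ (0≤* (QP.<⇒≤ (frac-pos 24 37631)) (0≤* (≤⇒0≤- 31≤96x) (QP.<⇒≤ (<⇒0<- 8x<5))))
                             (0≤* (QP.<⇒≤ (frac-pos 3303 37631)) 0≤x))
                (frac-pos 802 37631)

-- λ₂(k,ℓ) > k/ℓ whenever k < ℓ: in the outer branches λ₂ - x is (1 - x)/3, resp. (1 - x)/11 + 3/22.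
λ₂-above-diagonal : ∀ k ℓ' → k ℕ.< suc ℓ' → frac k (suc ℓ') <ᴱ λ₂ k (suc ℓ')
λ₂-above-diagonal k ℓ' k<ℓ =
  if-elim (x <ᴱ_) (5 ℕ.* ℓ ≤ᵇ 8 ℕ.* k) (λ _ → upper)
    (λ not-upper → if-elim (x <ᴱ_) (31 ℕ.* ℓ ≤ᵇ 96 ℕ.* k)
      (λ middle → λ₂-middle-above-diagonal k ℓ' (ℕP.≤ᵇ⇒≤ (31 ℕ.* ℓ) (96 ℕ.* k) middle) (¬≤ᵇ⇒> (5 ℕ.* ℓ) (8 ℕ.* k) not-upper))
      (λ _ → lower))
  where
  ℓ : ℕ
  ℓ = suc ℓ'
  x : ℚ
  x = frac k ℓ
  0<1-x : 0ℚ < 1ℚ - x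
  0<1-x = <⇒0<- (frac<1 k ℓ' k<ℓ)
  upper : x <ᴱ rat ((ι 2 ⊘ ι 3) * (x + ι 1 ⊘ ι 2))
  upper = from (<ᴱ-rat x _) (0<-⇒< (subst (0ℚ <_) (sym (gap x)) (0<* (frac-pos 0 2) 0<1-x)))
    where
    gap : ∀ x → (ι 2 ⊘ ι 3) * (x + ι 1 ⊘ ι 2) - x ≡ frac 1 3 * (1ℚ - x)
    gap = solve 1 (λ x → con (frac 2 3) :* (x :+ con (frac 1 2)) :- x := con (frac 1 3) :* (con 1ℚ :- x)) refl
  lower : x <ᴱ rat ((ι 10 ⊘ ι 11) * (x + ι 1 ⊘ ι 4))
  lower = from (<ᴱ-rat x _) (0<-⇒< (subst (0ℚ <_) (sym (gap x))
            (0≤+0< (0≤* (QP.<⇒≤ (frac-pos 0 10)) (QP.<⇒≤ 0<1-x)) (frac-pos 2 21))))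
    where
    gap : ∀ x → (ι 10 ⊘ ι 11) * (x + ι 1 ⊘ ι 4) - x ≡ frac 1 11 * (1ℚ - x) + frac 3 22
    gap = solve 1 (λ x → con (frac 10 11) :* (x :+ con (frac 1 4)) :- x
                         := con (frac 1 11) :* (con 1ℚ :- x) :+ con (frac 3 22)) refl

-- λ₂(k,ℓ) > 5/6 whenever k/ℓ ≥ 5/6: then the upper branch applies and λ₂ - 5/6 = (2/3)(x - 5/6) + 1/18.
λ₂-above-5/6 : ∀ k ℓ' → 5 ℕ.* suc ℓ' ℕ.≤ 6 ℕ.* k → frac 5 6 <ᴱ λ₂ k (suc ℓ')
λ₂-above-5/6 k ℓ' 5ℓ≤6k =
  if-elim (frac 5 6 <ᴱ_) (5 ℕ.* ℓ ≤ᵇ 8 ℕ.* k) (λ _ → upper) (λ not-upper → ⊥-elim (not-upper (ℕP.≤⇒≤ᵇ 5ℓ≤8k)))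
  where
  ℓ : ℕ
  ℓ = suc ℓ'
  x : ℚ
  x = frac k ℓ
  5ℓ≤8k : 5 ℕ.* ℓ ℕ.≤ 8 ℕ.* k
  5ℓ≤8k = ℕP.≤-trans 5ℓ≤6k (ℕP.*-monoˡ-≤ k (ℕP.m≤m+n 6 2))
  upper : frac 5 6 <ᴱ rat ((ι 2 ⊘ ι 3) * (x + ι 1 ⊘ ι 2))
  upper = from (<ᴱ-rat (frac 5 6) ((ι 2 ⊘ ι 3) * (x + ι 1 ⊘ ι 2))) (0<-⇒< (subst (0ℚ <_) (sym (gap x))
            (0≤+0< (0≤* (QP.<⇒≤ (frac-pos 1 2)) (≤⇒0≤- (5/6≤frac k ℓ' 5ℓ≤6k))) (frac-pos 0 17))))
    where
    gap : ∀ x → (ι 2 ⊘ ι 3) * (x + ι 1 ⊘ ι 2) - frac 5 6 ≡ frac 2 3 * (x - frac 5 6) + frac 1 18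
    gap = solve 1 (λ x → con (frac 2 3) :* (x :+ con (frac 1 2)) :- con (frac 5 6)
                         := con (frac 2 3) :* (x :- con (frac 5 6)) :+ con (frac 1 18)) refl

below-kTerm : ∀ k ℓ' q → 1 ℕ.≤ k → q ≤ frac 1 (suc ℓ') → q <ᴱ kTerm k (suc ℓ')
below-kTerm 1 ℓ' q _ _ = tt
below-kTerm (suc (suc j)) ℓ' q _ q≤1/ℓ =
  from (<ᴱ-rat q _) (QP.≤-<-trans q≤1/ℓ (subst (frac 1 ℓ <_) (sym kTerm-value) 1/ℓ<k/ℓ[k-1]))
  where
  ℓ : ℕ
  ℓ = suc ℓ'
  k : ℕ
  k = suc (suc j)
  kTerm-value : ι k ⊘ (ι ℓ * (ι k - ι 1)) ≡ frac k (ℓ ℕ.* suc j)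
  kTerm-value = cong (ι k ⊘_) (trans (cong (ι ℓ *_) (ι-difference 1 (suc j))) (ι-* ℓ (suc j)))
  1/ℓ<k/ℓ[k-1] : frac 1 ℓ < frac k (ℓ ℕ.* suc j)
  1/ℓ<k/ℓ[k-1] = frac-< {1} {ℓ'} {k} {ℕ.pred (ℓ ℕ.* suc j)}
    (subst₂ ℕ._<_ (sym (ℕP.*-identityˡ (ℓ ℕ.* suc j))) (ℕP.*-comm ℓ k) (ℕP.*-monoʳ-< ℓ (ℕP.n<1+n (suc j))))

θLZ-≤ : ∀ k ℓ' → θLZ k (suc ℓ') ≤ frac 1 (suc ℓ')
θLZ-≤ k ℓ' = QP.p⊓q≤q (frac 5 (6 ℕ.* k)) (frac 1 (suc ℓ'))

kθLZ-small : ∀ k' ℓ' → 6 ℕ.* suc k' ℕ.≤ 5 ℕ.* suc ℓ' → ι (suc k') * θLZ (suc k') (suc ℓ') ≡ frac (suc k') (suc ℓ')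
kθLZ-small k' ℓ' 6k≤5ℓ = trans (cong (ι (suc k') *_) θLZ≡1/ℓ) (ι-*-unit-frac (suc k') ℓ')
  where
  θLZ≡1/ℓ : θLZ (suc k') (suc ℓ') ≡ frac 1 (suc ℓ')
  θLZ≡1/ℓ = QP.p≥q⇒p⊓q≡q (frac-≤ {1} {ℓ'} {5} {ℕ.pred (6 ℕ.* suc k')}
              (subst (ℕ._≤ 5 ℕ.* suc ℓ') (sym (ℕP.*-identityˡ (6 ℕ.* suc k'))) 6k≤5ℓ))

kθLZ-large : ∀ k' ℓ' → 5 ℕ.* suc ℓ' ℕ.< 6 ℕ.* suc k' → ι (suc k') * θLZ (suc k') (suc ℓ') ≡ frac 5 6
kθLZ-large k' ℓ' 5ℓ<6k = trans (cong (ι (suc k') *_) θLZ≡5/6k) (ι-*-frac-cancel k' 5 5)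
  where
  θLZ≡5/6k : θLZ (suc k') (suc ℓ') ≡ frac 5 (6 ℕ.* suc k')
  θLZ≡5/6k = QP.p≤q⇒p⊓q≡p (frac-≤ {5} {ℕ.pred (6 ℕ.* suc k')} {1} {ℓ'}
               (subst (5 ℕ.* suc ℓ' ℕ.≤_) (sym (ℕP.*-identityˡ (6 ℕ.* suc k'))) (ℕP.<⇒≤ 5ℓ<6k)))

-- In both regimes k·θ_LZ(k,ℓ) < λ₂(k,ℓ): it is x < 1 or 5/6 ≤ x.
kθLZ-below-λ₂ : ∀ k' ℓ' → ι (suc k') * θLZ (suc k') (suc ℓ') <ᴱ λ₂ (suc k') (suc ℓ')
kθLZ-below-λ₂ k' ℓ' = [ small , large ]′ (ℕP.≤-<-connex (6 ℕ.* suc k') (5 ℕ.* suc ℓ'))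
  where
  small : 6 ℕ.* suc k' ℕ.≤ 5 ℕ.* suc ℓ' → ι (suc k') * θLZ (suc k') (suc ℓ') <ᴱ λ₂ (suc k') (suc ℓ')
  small 6k≤5ℓ = subst (_<ᴱ λ₂ (suc k') (suc ℓ')) (sym (kθLZ-small k' ℓ' 6k≤5ℓ))
                  (λ₂-above-diagonal (suc k') ℓ' (small-regime⇒k<ℓ (suc k') ℓ' 6k≤5ℓ))
  large : 5 ℕ.* suc ℓ' ℕ.< 6 ℕ.* suc k' → ι (suc k') * θLZ (suc k') (suc ℓ') <ᴱ λ₂ (suc k') (suc ℓ')
  large 5ℓ<6k = subst (_<ᴱ λ₂ (suc k') (suc ℓ')) (sym (kθLZ-large k' ℓ' 5ℓ<6k))
                  (λ₂-above-5/6 (suc k') ℓ' (ℕP.<⇒≤ 5ℓ<6k))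

-- Of the three terms of θ_A, only the λ₁-term can fail to exceed θ_LZ.
θA-cut : ∀ k' ℓ' → let k = suc k' ; ℓ = suc ℓ' in
  (θLZ k ℓ <ᴱ θA k ℓ) ⇔ (ι k * θLZ k ℓ <ᴱ λ₁ ℓ)
θA-cut k' ℓ' = mk⇔ (λ (q<λ₁/k , _) → to (unscale (λ₁ ℓ)) q<λ₁/k) below-θA
  where
  k : ℕ
  k = suc k'
  ℓ : ℕ
  ℓ = suc ℓ'
  q : ℚ
  q = θLZ k ℓ
  unscale : ∀ e → (q <ᴱ scale (frac 1 k) e) ⇔ (ι k * q <ᴱ e)
  unscale e = <ᴱ-unscale q e (ι-pos k') (ι-*-inverse k')
  below-θA : ι k * q <ᴱ λ₁ ℓ → q <ᴱ θA k ℓ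
  below-θA kq<λ₁ = from (unscale (λ₁ ℓ)) kq<λ₁ , from (unscale (λ₂ k ℓ)) (kθLZ-below-λ₂ k' ℓ') ,
                   below-kTerm k ℓ' q (s≤s z≤n) (θLZ-≤ k ℓ')

-- θ_B adds nothing: θ_LZ < 5/(12k) gives k·θ_LZ < 5/12 < λ₁(ℓ).
θB-cut : ∀ k' ℓ' → let k = suc k' ; ℓ = suc ℓ' in
  2 ℕ.≤ ℓ → θLZ k ℓ <ᴱ θB k ℓ → ι k * θLZ k ℓ <ᴱ λ₁ ℓ
θB-cut k' ℓ' 2≤ℓ (q<5/12k , _) = <ᴱ-downward (λ₁ (suc ℓ')) (QP.<⇒≤ kq<5/12) (λ₁-above-5/12 (suc ℓ') 2≤ℓ)
  where
  kq<5/12 : ι (suc k') * θLZ (suc k') (suc ℓ') < frac 5 12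
  kq<5/12 = to (*-<-⇔ (ι-pos k') refl (ι-*-frac-cancel k' 5 11)) (to (<ᴱ-rat _ _) q<5/12k)

θ-cut : ∀ k' ℓ' → let k = suc k' ; ℓ = suc ℓ' in
  2 ℕ.≤ ℓ → (θLZ k ℓ <ᴱ θ k ℓ) ⇔ (ι k * θLZ k ℓ <ᴱ λ₁ ℓ)
θ-cut k' ℓ' 2≤ℓ = mk⇔ [ to (θA-cut k' ℓ') , θB-cut k' ℓ' 2≤ℓ ]′ (inj₁ ∘ from (θA-cut k' ℓ'))

kθLZ-cut : ∀ k' ℓ' → let k = suc k' ; ℓ = suc ℓ' in
  2 ℕ.≤ ℓ → (ι k * θLZ k ℓ <ᴱ λ₁ ℓ) ⇔ ((ℓ ≡ 2) ⊎ (frac k ℓ <ᴱ λ₁ ℓ))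
kθLZ-cut k' ℓ' 2≤ℓ = [ small , large ]′ (ℕP.≤-<-connex (6 ℕ.* k) (5 ℕ.* ℓ))
  where
  k : ℕ
  k = suc k'
  ℓ : ℕ
  ℓ = suc ℓ'
  RHS : Set
  RHS = (ℓ ≡ 2) ⊎ (frac k ℓ <ᴱ λ₁ ℓ)
  -- here k·θ_LZ = x, and for ℓ = 2 we have x < 1 = λ₁(2)
  small : 6 ℕ.* k ℕ.≤ 5 ℕ.* ℓ → (ι k * θLZ k ℓ <ᴱ λ₁ ℓ) ⇔ RHS
  small 6k≤5ℓ = subst (λ t → (t <ᴱ λ₁ ℓ) ⇔ RHS) (sym (kθLZ-small k' ℓ' 6k≤5ℓ))
    (mk⇔ inj₂ [ (λ { refl → from (<ᴱ-rat _ 1ℚ) (frac<1 k ℓ' (small-regime⇒k<ℓ k ℓ' 6k≤5ℓ)) }) , id ]′)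
  -- here k·θ_LZ = 5/6 ≤ x, and only λ₁(2) exceeds 5/6
  large : 5 ℕ.* ℓ ℕ.< 6 ℕ.* k → (ι k * θLZ k ℓ <ᴱ λ₁ ℓ) ⇔ RHS
  large 5ℓ<6k = subst (λ t → (t <ᴱ λ₁ ℓ) ⇔ RHS) (sym (kθLZ-large k' ℓ' 5ℓ<6k))
    (mk⇔ (inj₁ ∘ to only-two)
         [ from only-two , <ᴱ-downward (λ₁ ℓ) (5/6≤frac k ℓ' (ℕP.<⇒≤ 5ℓ<6k)) ]′)
    where
    only-two : (frac 5 6 <ᴱ λ₁ ℓ) ⇔ (ℓ ≡ 2)
    only-two = λ₁-above-5/6⇔ℓ≡2 ℓ 2≤ℓ

target-cut : ∀ k ℓ' → (ι k <ᴱ scale (ι (suc ℓ')) (λ₁ (suc ℓ'))) ⇔ (frac k (suc ℓ') <ᴱ λ₁ (suc ℓ'))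
target-cut k ℓ' = subst (λ t → (ι k <ᴱ scale (ι (suc ℓ')) (λ₁ (suc ℓ'))) ⇔ (t <ᴱ λ₁ (suc ℓ')))
  (trans (QP.*-comm (frac 1 (suc ℓ')) (ι k)) (ι-*-unit-frac k ℓ'))
  (<ᴱ-unscale (ι k) (λ₁ (suc ℓ')) (frac-pos 0 ℓ') (trans (QP.*-comm (frac 1 (suc ℓ')) (ι (suc ℓ'))) (ι-*-inverse ℓ')))

lemma7p2 : (k ℓ : ℕ) → 1 ℕ.≤ k → 2 ℕ.≤ ℓ →
    (θLZ k ℓ <ᴱ θ k ℓ) ⇔ ((ℓ ≡ 2) ⊎ (ι k <ᴱ scale (ι ℓ) (λ₁ ℓ)))
lemma7p2 (suc k') (suc ℓ') _ 2≤ℓ =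
  ⇔-trans (θ-cut k' ℓ' 2≤ℓ) (⇔-trans (kθLZ-cut k' ℓ' 2≤ℓ) (⇔-refl {x = suc ℓ' ≡ 2} ⊎-⇔ ⇔-sym (target-cut (suc k') ℓ')))
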